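{- For all g-languages $\mathcal{L},\mathcal{L}'$: (monotonicity) $\mathcal{L}\subseteq\mathcal{L}'$ implies $[\![\mathcal{L}{\upharpoonright}]\!]\subseteq[\![\mathcal{L}'{\upharpoonright}]\!]$; (extensiveness) $\mathcal{L}\subseteq[\![\mathcal{L}{\upharpoonright}]\!]$; (idempotency) $[\![\mathcal{L}{\upharpoonright}]\!]=[\![\,[\![\mathcal{L}{\upharpoonright}]\!]{\upharpoonright}\,]\!]$.
   Context: Fix disjoint sets $\mathfrak{P}$ (participants) and $\mathfrak{M}$ (messages). Interactions $\Sigma_{int}=\{A\to B{:}m\mid A\neq B\in\mathfrak{P},m\in\mathfrak{M}\}$, actions $\Sigma_{act}=\{AB!m,AB?m\}$ (subject of $AB!m$ is $A$, of $AB?m$ is $B$); $\Sigma^\infty$: finite and infinite words; $\mathrm{ptp}$: set of participants occurring. A g-language is a prefix-closed $\mathcal{L}\subseteq\Sigma_{int}^\infty$ with $\mathrm{ptp}(\mathcal{L})$ finite. A system over a finite $P\subseteq\mathfrak{P}$ maps each $A\in P$ to a prefix-closed set $S(A)\neq\{\varepsilon\}$ of finite/infinite action words all with subject $A$ and participants in $P$. Projection: $(A\to B{:}m){\upharpoonright}_A=AB!m$, $(A\to B{:}m){\upharpoonright}_B=AB?m$, $\varepsilon$ for other participants, extended homomorphically to words and languages; $\mathcal{L}{\upharpoonright}=(\mathcal{L}{\upharpoonright}_A)_{A\in\mathrm{ptp}(\mathcal{L})}$. Semantics: $[\![S]\!]=\{w\in\Sigma_{int}^\infty\mid\mathrm{ptp}(w)\subseteq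 P,\ w{\upharpoonright}_A\in S(A)\ \forall A\in P\}$. -}

module Defs where

open import Data.Nat using (ℕ; zero; suc)
open import Data.Maybe using (Maybe; just; nothing)
open import Data.List using (List; []; _∷_; _++_; [_])
open import Data.List.Membership.Propositional using (_∈_)
open import Data.Product using (Σ; ∃; ∃₂; _×_; _,_)
open import Data.Sum using (_⊎_)
open import Relation.Binary.PropositionalEquality using (_≡_; _≢_)

-- Finite and infinite words (Σ^∞): a word is a sequence of optional
-- letters in which "nothing" (end of word) is absorbing.  A finite word
-- of length k has letters at positions < k and nothing afterwards.

record Word (X : Set) : Set where
  field
    at   : ℕ → Maybe X
    stop : ∀ n → at n ≡ nothing → at (suc n) ≡ nothing
open Word public

-- equality of words (pointwise; the real equality of sequences)
_≈_ : {X : Set} → Word X → Word X → Set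
u ≈ w = ∀ n → at u n ≡ at w n

Prefix : {X : Set} → Word X → Word X → Set
Prefix u w = ∀ n → (at u n ≡ nothing) ⊎ (at u n ≡ at w n)

toL : {X : Set} → Maybe X → List X
toL (just x) = [ x ]
toL nothing  = []

pre : {X : Set} → Word X → ℕ → List X
pre w zero    = []
pre w (suc n) = pre w n ++ toL (at w n)

Lang : Set → Set₁
Lang X = Word X → Set

_⊆_ : {X : Set} → Lang X → Lang X → Set
L ⊆ L' = ∀ w → L w → L' w

_≐_ : {X : Set} → Lang X → Lang X → Set
L ≐ L' = (L ⊆ L') × (L' ⊆ L)

record Int (𝔓 𝔐 : Set) : Set where
  constructor _⇒_∶_
  field
    from : 𝔓
    to   : 𝔓
    msg  : 𝔐
open Int public

data Act (𝔓 𝔐 : Set) : Set where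
  send : 𝔓 → 𝔓 → 𝔐 → Act 𝔓 𝔐
  recv : 𝔓 → 𝔓 → 𝔐 → Act 𝔓 𝔐

module _ {𝔓 𝔐 : Set} where

  -- word over Σ_int : every interaction A → B : m has A ≠ B
  WfInt : Word (Int 𝔓 𝔐) → Set
  WfInt w = ∀ n i → at w n ≡ just i → from i ≢ to i

  Occurs : 𝔓 → Word (Int 𝔓 𝔐) → Set
  Occurs A w = ∃₂ λ n i → (at w n ≡ just i) × ((A ≡ from i) ⊎ (A ≡ to i))

  ptp : Lang (Int 𝔓 𝔐) → 𝔓 → Set
  ptp L A = ∃ λ w → L w × Occurs A w

  data ProjI : 𝔓 → Int 𝔓 𝔐 → List (Act 𝔓 𝔐) → Set where
    pS : ∀ {A B m} → ProjI A (A ⇒ B ∶ m) [ send A B m ]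
    pR : ∀ {A B m} → ProjI B (A ⇒ B ∶ m) [ recv A B m ]
    pO : ∀ {C A B m} → C ≢ A → C ≢ B → ProjI C (A ⇒ B ∶ m) []

  data ProjL (C : 𝔓) : List (Int 𝔓 𝔐) → List (Act 𝔓 𝔐) → Set where
    []  : ProjL C [] []
    _∷_ : ∀ {i w u v} → ProjI C i u → ProjL C w v → ProjL C (i ∷ w) (u ++ v)

  -- extension to finite/infinite words (by continuity):
  -- u = w↾C iff the projections of the finite prefixes of w are exactly
  -- (up to prefix) the finite prefixes of u.
  ProjW : 𝔓 → Word (Int 𝔓 𝔐) → Word (Act 𝔓 𝔐) → Set
  ProjW C w u =
    (∀ n v → ProjL C (pre w n) v → ∃ λ k → pre u k ≡ v)
    × (∀ k → ∃₂ λ n v → ProjL C (pre w n) v × ∃ λ r → v ≡ pre u k ++ r)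

  record IsGLang (L : Lang (Int 𝔓 𝔐)) : Set where
    field
      overΣint      : ∀ w → L w → WfInt w
      respects≈     : ∀ u w → u ≈ w → L u → L w
      prefixClosed  : ∀ w u → L w → Prefix u w → L u
      finitePtp     : ∃ λ (ps : List 𝔓) → ∀ A → ptp L A → A ∈ ps

  _↾_ : Lang (Int 𝔓 𝔐) → 𝔓 → Lang (Act 𝔓 𝔐)
  (L ↾ A) u = ∃ λ w → L w × ProjW A w u

  ⟦_,_⟧ : (𝔓 → Set) → (𝔓 → Lang (Act 𝔓 𝔐)) → Lang (Int 𝔓 𝔐)
  ⟦ P , S ⟧ w = WfInt w
              × (∀ A → Occurs A w → P A)
              × (∀ A → P A → ∀ u → ProjW A w u → S A u)

  ⟦_↾⟧ : Lang (Int 𝔓 𝔐) → Lang (Int 𝔓 𝔐)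
  ⟦ L ↾⟧ = ⟦ ptp L , (λ A → L ↾ A) ⟧

{-# OPTIONS --safe #-}
-- The projections of L all come from words of L, so every word of L is
-- re-assembled by its own projections (extensiveness), and enlarging L
-- enlarges each projection.  The only subtlety in monotonicity is a
-- participant of L' that does not occur in L: its projection of a word of
-- ⟦ L ↾⟧ must be empty (a non-empty projection witnesses an occurrence),
-- and the empty word is the projection of the empty interaction word, which
-- lies in the prefix-closed L'.  Idempotency holds because ⟦ L ↾⟧ and L
-- have the same participants and the same projections.
module Submission where

open import Defs
open import Data.Product using (_×_; _,_; ∃; proj₁)
open import Data.Nat using (ℕ; zero; suc)
open import Data.Maybe using (just; nothing)
open import Data.List using (List; []; _∷_; _++_)
open import Data.List.Properties using (++-identityʳ)
open import Data.List.Membership.Propositional using (_∈_)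
open import Data.List.Membership.Propositional.Properties using (∈-++⁻)
open import Data.List.Relation.Unary.Any using (here; there)
open import Data.Sum using (_⊎_; inj₁; inj₂)
open import Relation.Binary.PropositionalEquality
  using (_≡_; refl; sym; trans; cong; subst)

module _ {X : Set} where

  ε : Word X
  ε = record { at = λ _ → nothing ; stop = λ _ _ → refl }

  at-0≡nothing⇒at≡nothing : (u : Word X) → at u 0 ≡ nothing → ∀ n → at u n ≡ nothing
  at-0≡nothing⇒at≡nothing u e zero    = e
  at-0≡nothing⇒at≡nothing u e (suc n) = stop u n (at-0≡nothing⇒at≡nothing u e n)

  at-0≡nothing⇒pre≡[] : (u : Word X) → at u 0 ≡ nothing → ∀ k → pre u k ≡ []
  at-0≡nothing⇒pre≡[] u e zero = refl
  at-0≡nothing⇒pre≡[] u e (suc k)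
    rewrite at-0≡nothing⇒at≡nothing u e k | ++-identityʳ (pre u k) = at-0≡nothing⇒pre≡[] u e k

  pre-ε : ∀ k → pre ε k ≡ []
  pre-ε = at-0≡nothing⇒pre≡[] ε refl

  ∈-pre⇒at : (w : Word X) (n : ℕ) {x : X} → x ∈ pre w n → ∃ λ m → at w m ≡ just x
  ∈-pre⇒at w zero    ()
  ∈-pre⇒at w (suc n) x∈ with ∈-++⁻ (pre w n) x∈
  ... | inj₁ x∈pre = ∈-pre⇒at w n x∈pre
  ... | inj₂ x∈last with at w n in eq
  ...   | just _ with x∈last
  ...     | here refl = n , eq

module _ {𝔓 𝔐 : Set} where

  ProjL-[] : ∀ {C : 𝔓} {v : List (Act 𝔓 𝔐)} → ProjL C [] v → v ≡ []
  ProjL-[] [] = refl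

  ProjL-∷⇒participant : ∀ {C : 𝔓} {l : List (Int 𝔓 𝔐)} {v a r} →
    ProjL C l v → v ≡ a ∷ r → ∃ λ i → i ∈ l × ((C ≡ from i) ⊎ (C ≡ to i))
  ProjL-∷⇒participant (pS ∷ _)     _ = _ , here refl , inj₁ refl
  ProjL-∷⇒participant (pR ∷ _)     _ = _ , here refl , inj₂ refl
  ProjL-∷⇒participant (pO _ _ ∷ p) e with ProjL-∷⇒participant p e
  ... | i , i∈l , C∈i = i , there i∈l , C∈i

  -- The first letter of u is the first letter of u's prefix of length 1,
  -- which is the start of the projection of some finite prefix of w.
  ProjW-nonempty⇒Occurs : ∀ {A w u a} → ProjW A w u → at u 0 ≡ just a → Occurs A w
  ProjW-nonempty⇒Occurs {w = w} (_ , covers) e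
    with covers 1
  ... | n , v , proj , r , v≡ with ProjL-∷⇒participant proj (trans v≡ (cong (λ x → toL x ++ r) e))
  ...   | i , i∈pre , A∈i with ∈-pre⇒at w n i∈pre
  ...     | m , at≡ = m , i , at≡ , A∈i

  ProjW-ε : ∀ {A : 𝔓} {u : Word (Act 𝔓 𝔐)} → at u 0 ≡ nothing → ProjW A ε u
  ProjW-ε {u = u} e =
    (λ n v proj → 0 , sym (ProjL-[] (subst (λ l → ProjL _ l v) (pre-ε n) proj))) ,
    (λ k → 0 , [] , [] , [] , sym (trans (++-identityʳ (pre u k)) (at-0≡nothing⇒pre≡[] u e k)))

  empty∈↾ : ∀ {L : Lang (Int 𝔓 𝔐)} → IsGLang L → ∀ {w} → L w →
    ∀ A {u} → at u 0 ≡ nothing → (L ↾ A) u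
  empty∈↾ G {w} Lw A e = ε , IsGLang.prefixClosed G w ε Lw (λ _ → inj₁ refl) , ProjW-ε e

  ptp-mono : ∀ {L L' : Lang (Int 𝔓 𝔐)} → L ⊆ L' → ∀ A → ptp L A → ptp L' A
  ptp-mono L⊆L' A (w , Lw , occ) = w , L⊆L' w Lw , occ

  ↾-mono : ∀ {L L' : Lang (Int 𝔓 𝔐)} → L ⊆ L' → ∀ A → (L ↾ A) ⊆ (L' ↾ A)
  ↾-mono L⊆L' A u (w , Lw , proj) = w , L⊆L' w Lw , proj

  ⊆⟦↾⟧ : ∀ (L : Lang (Int 𝔓 𝔐)) → (∀ w → L w → WfInt w) → L ⊆ ⟦ L ↾⟧
  ⊆⟦↾⟧ L wf w Lw = wf w Lw , (λ A occ → w , Lw , occ) , (λ A _ u proj → w , Lw , proj)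

  ⟦↾⟧-mono : ∀ {L L' : Lang (Int 𝔓 𝔐)} → IsGLang L' → L ⊆ L' → ⟦ L ↾⟧ ⊆ ⟦ L' ↾⟧
  ⟦↾⟧-mono {L} {L'} G' L⊆L' w (wf , occ⇒ptp , proj⇒↾) =
    wf , (λ A occ → ptp-mono L⊆L' A (occ⇒ptp A occ)) , proj⇒↾'
    where
    proj⇒↾' : ∀ A → ptp L' A → ∀ u → ProjW A w u → (L' ↾ A) u
    proj⇒↾' A (w' , L'w' , _) u proj with at u 0 in e
    ... | nothing = empty∈↾ G' L'w' A e
    ... | just _  = ↾-mono L⊆L' A u
                      (proj⇒↾ A (occ⇒ptp A (ProjW-nonempty⇒Occurs proj e)) u proj)

  ptp-⟦↾⟧ : ∀ (L : Lang (Int 𝔓 𝔐)) A → ptp ⟦ L ↾⟧ A → ptp L A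
  ptp-⟦↾⟧ L A (w , (_ , occ⇒ptp , _) , occ) = occ⇒ptp A occ

  ⟦↾⟧↾⊆↾ : ∀ (L : Lang (Int 𝔓 𝔐)) A → ptp L A → (⟦ L ↾⟧ ↾ A) ⊆ (L ↾ A)
  ⟦↾⟧↾⊆↾ L A A∈ u (w , (_ , _ , proj⇒↾) , proj) = proj⇒↾ A A∈ u proj

  ⟦⟦↾⟧↾⟧⊆⟦↾⟧ : ∀ {L : Lang (Int 𝔓 𝔐)} → IsGLang L → ⟦ ⟦ L ↾⟧ ↾⟧ ⊆ ⟦ L ↾⟧
  ⟦⟦↾⟧↾⟧⊆⟦↾⟧ {L} G w (wf , occ⇒ptp , proj⇒↾) =
    wf ,
    (λ A occ → ptp-⟦↾⟧ L A (occ⇒ptp A occ)) ,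
    (λ A A∈ u proj → ⟦↾⟧↾⊆↾ L A A∈ u
       (proj⇒↾ A (ptp-mono (⊆⟦↾⟧ L (IsGLang.overΣint G)) A A∈) u proj))

corollary2p16 : {𝔓 𝔐 : Set} (L L' : Lang (Int 𝔓 𝔐)) → IsGLang L → IsGLang L' →
    ((L ⊆ L') → (⟦ L ↾⟧ ⊆ ⟦ L' ↾⟧))
    × (L ⊆ ⟦ L ↾⟧)
    × (⟦ L ↾⟧ ≐ ⟦ ⟦ L ↾⟧ ↾⟧)
corollary2p16 L L' G G' =
  ⟦↾⟧-mono G' ,
  ⊆⟦↾⟧ L (IsGLang.overΣint G) ,
  ⊆⟦↾⟧ ⟦ L ↾⟧ (λ _ → proj₁) ,
  ⟦⟦↾⟧↾⟧⊆⟦↾⟧ G
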